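{- Let $(O,\perp)$ be an orthoset and let $X,Y\subseteq O$. Then $X$ is orthoclosed and $Y=X^\perp$ if and only if $X\perp Y$ and for every $z\in O\setminus(X\cup Y)$ there exist $x\in X$ and $y\in Y$ such that $z\not\perp x$ and $z\not\perp y$.
   Context: An orthoset $(O,\perp)$ is a set $O$ with an irreflexive symmetric binary relation $\perp$. For $X,Y\subseteq O$, $X\perp Y$ means $x\perp y$ for all $x\in X$, $y\in Y$. For $X\subseteq O$, $X^\perp=\{y\in O\mid y\perp x \text{ for all } x\in X\}$. A subset $X$ is orthoclosed if $X=X^{\perp\perp}$. -}

module Defs where

open import Level using (Level; suc)
open import Data.Empty using (⊥)
open import Data.Product using (Σ-syntax; _×_)
open import Data.Sum using (_⊎_)
open import Relation.Nullary using (¬_)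
open import Relation.Binary using (Rel)
open import Relation.Unary using (Pred; _∈_; _∉_; _≐_; _∪_)

record Orthoset (ℓ : Level) : Set (suc ℓ) where
  field
    Carrier : Set ℓ
    _⟂_     : Rel Carrier ℓ
    ⟂-irrefl : ∀ {x} → ¬ (x ⟂ x)
    ⟂-sym    : ∀ {x y} → x ⟂ y → y ⟂ x

module _ {ℓ : Level} (O : Orthoset ℓ) where
  open Orthoset O

  _⊥ˢ_ : Pred Carrier ℓ → Pred Carrier ℓ → Set ℓ
  X ⊥ˢ Y = ∀ {x y} → x ∈ X → y ∈ Y → x ⟂ y

  _ᗮ : Pred Carrier ℓ → Pred Carrier ℓ
  (X ᗮ) y = ∀ {x} → x ∈ X → y ⟂ x

  Orthoclosed : Pred Carrier ℓ → Set ℓ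
  Orthoclosed X = X ≐ ((X ᗮ) ᗮ)

-- Classically, z ∉ Aᗮ says exactly that z is non-orthogonal to some element of A.
-- If X is orthoclosed with complement Y, a z outside X ∪ Y therefore lies neither in
-- Xᗮ nor in Xᗮᗮ, which yields the two witnesses. Conversely, the witness condition
-- forces every z ∈ Xᗮ (which avoids X by irreflexivity) into Y, and symmetrically
-- Yᗮ ⊆ X; since X ⊥ Y gives Xᗮᗮ ⊆ Yᗮ, X is orthoclosed and Y = Xᗮ.
module Submission where

open import Defs
open import Level using (Level)
open import Axiom.ExcludedMiddle using (ExcludedMiddle)
open import Axiom.DoubleNegationElimination using (em⇒dne)
open import Data.Product using (Σ-syntax; _×_; _,_)
open import Data.Sum using (inj₁; inj₂; [_,_])
open import Function using (_∘_)
open import Function.Bundles using (_⇔_; mk⇔)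
open import Relation.Nullary using (¬_)
open import Relation.Unary using (Pred; _∈_; _∉_; _⊆_; _≐_; _∪_)

module _ {ℓ : Level} (O : Orthoset ℓ) where
  open Orthoset O

  NonOrthogonal : Pred Carrier ℓ → Pred Carrier ℓ
  NonOrthogonal A z = Σ[ x ∈ Carrier ] (x ∈ A × ¬ z ⟂ x)

  OrthoclosedWithComplement : Pred Carrier ℓ → Pred Carrier ℓ → Set ℓ
  OrthoclosedWithComplement X Y = Orthoclosed O X × Y ≐ _ᗮ O X

  OrthogonalCover : Pred Carrier ℓ → Pred Carrier ℓ → Set ℓ
  OrthogonalCover X Y =
    _⊥ˢ_ O X Y × (∀ z → z ∉ (X ∪ Y)
      → Σ[ x ∈ Carrier ] Σ[ y ∈ Carrier ] (x ∈ X × y ∈ Y × ¬ z ⟂ x × ¬ z ⟂ y))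

  ⊆ᗮᗮ : ∀ {X} → X ⊆ _ᗮ O (_ᗮ O X)
  ⊆ᗮᗮ x∈X y∈Xᗮ = ⟂-sym (y∈Xᗮ x∈X)

  ᗮ-antitone : ∀ {X Y} → X ⊆ Y → _ᗮ O Y ⊆ _ᗮ O X
  ᗮ-antitone X⊆Y z∈Yᗮ x∈X = z∈Yᗮ (X⊆Y x∈X)

  ⊥ˢ⇒⊆ᗮ : ∀ {X Y} → _⊥ˢ_ O X Y → Y ⊆ _ᗮ O X
  ⊥ˢ⇒⊆ᗮ X⊥Y y∈Y x∈X = ⟂-sym (X⊥Y x∈X y∈Y)

  ∈ᗮ⇒∉ : ∀ {X z} → z ∈ _ᗮ O X → z ∉ X
  ∈ᗮ⇒∉ z∈Xᗮ z∈X = ⟂-irrefl (z∈Xᗮ z∈X)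

  module _ (em : ExcludedMiddle ℓ) where

    ∉ᗮ⇒NonOrthogonal : ∀ {A z} → z ∉ _ᗮ O A → NonOrthogonal A z
    ∉ᗮ⇒NonOrthogonal z∉Aᗮ = em⇒dne em λ ¬nonOrth →
      z∉Aᗮ λ {x} x∈A → em⇒dne em λ ¬z⟂x → ¬nonOrth (x , x∈A , ¬z⟂x)

    ᗮ⊆-if-outside-NonOrthogonal : ∀ {A B}
      → (∀ z → z ∉ (A ∪ B) → NonOrthogonal A z) → _ᗮ O A ⊆ B
    ᗮ⊆-if-outside-NonOrthogonal nonOrth {z} z∈Aᗮ = em⇒dne em λ z∉B →
      let (x , x∈A , ¬z⟂x) = nonOrth z [ ∈ᗮ⇒∉ z∈Aᗮ , z∉B ]
      in ¬z⟂x (z∈Aᗮ x∈A)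

    complement⇒cover : ∀ {X Y} → OrthoclosedWithComplement X Y → OrthogonalCover X Y
    complement⇒cover {X} {Y} ((_ , Xᗮᗮ⊆X) , (Y⊆Xᗮ , Xᗮ⊆Y)) =
      (λ x∈X y∈Y → ⟂-sym (Y⊆Xᗮ y∈Y x∈X)) , witnesses
      where
      witnesses : ∀ z → z ∉ (X ∪ Y)
        → Σ[ x ∈ Carrier ] Σ[ y ∈ Carrier ] (x ∈ X × y ∈ Y × ¬ z ⟂ x × ¬ z ⟂ y)
      witnesses z z∉X∪Y =
        let (x , x∈X , ¬z⟂x) = ∉ᗮ⇒NonOrthogonal (z∉X∪Y ∘ inj₂ ∘ Xᗮ⊆Y)
            (y , y∈Xᗮ , ¬z⟂y) = ∉ᗮ⇒NonOrthogonal (z∉X∪Y ∘ inj₁ ∘ Xᗮᗮ⊆X)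
        in x , y , x∈X , Xᗮ⊆Y y∈Xᗮ , ¬z⟂x , ¬z⟂y

    cover⇒complement : ∀ {X Y} → OrthogonalCover X Y → OrthoclosedWithComplement X Y
    cover⇒complement {X} {Y} (X⊥Y , witnesses) =
      (⊆ᗮᗮ , Yᗮ⊆X ∘ ᗮ-antitone Y⊆Xᗮ) , (Y⊆Xᗮ , Xᗮ⊆Y)
      where
      Y⊆Xᗮ : Y ⊆ _ᗮ O X
      Y⊆Xᗮ = ⊥ˢ⇒⊆ᗮ X⊥Y

      Xᗮ⊆Y : _ᗮ O X ⊆ Y
      Xᗮ⊆Y = ᗮ⊆-if-outside-NonOrthogonal λ z z∉X∪Y →
        let (x , _ , x∈X , _ , ¬z⟂x , _) = witnesses z z∉X∪Y in x , x∈X , ¬z⟂x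

      Yᗮ⊆X : _ᗮ O Y ⊆ X
      Yᗮ⊆X = ᗮ⊆-if-outside-NonOrthogonal λ z z∉Y∪X →
        let (_ , y , _ , y∈Y , _ , ¬z⟂y) = witnesses z [ z∉Y∪X ∘ inj₂ , z∉Y∪X ∘ inj₁ ]
        in y , y∈Y , ¬z⟂y

lemma2p3 : {ℓ : Level} → ExcludedMiddle ℓ → (O : Orthoset ℓ)
    → (X Y : Pred (Orthoset.Carrier O) ℓ)
    → (Orthoclosed O X × Y ≐ _ᗮ O X)
      ⇔ (_⊥ˢ_ O X Y × (∀ z → z ∉ (X ∪ Y)
          → Σ[ x ∈ Orthoset.Carrier O ] Σ[ y ∈ Orthoset.Carrier O ]
              (x ∈ X × y ∈ Y × ¬ Orthoset._⟂_ O z x × ¬ Orthoset._⟂_ O z y)))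
lemma2p3 em O X Y = mk⇔ (complement⇒cover O em) (cover⇒complement O em)
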